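{- Let $G$ be a finite tree with a proper edge coloring $\kappa$. Then $\operatorname{Aut}_\kappa(G)$ is either trivial or has order two.
   Context: A proper edge coloring of $G$ on $k$ colors is a surjective map $\kappa:E(G)\to[k]$ such that edges sharing a vertex receive different colors. $\operatorname{Aut}_\kappa(G)$ is the group of permutations $\sigma$ of $V(G)$ such that for every color $a$, $\{i,j\}$ is an edge colored $a$ if and only if $\{\sigma(i),\sigma(j)\}$ is an edge colored $a$. -}

module Defs where

open import Data.Nat using (ℕ; suc; _≤_)
open import Data.Bool using (Bool; T)
open import Data.Fin using (Fin)
open import Data.List using (List; []; _∷_; length; last)
open import Data.List.Relation.Unary.Unique.Propositional using (Unique)
open import Data.Maybe using (just)
open import Data.Product using (Σ; ∃; _×_; _,_)
open import Relation.Nullary using (¬_)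
open import Data.Empty using (⊥)
open import Relation.Binary.PropositionalEquality using (_≡_)
open import Data.Fin.Permutation using (Permutation′; _⟨$⟩ʳ_)

record Graph (n : ℕ) : Set where
  field
    adj     : Fin n → Fin n → Bool
    adj-sym : ∀ i j → adj i j ≡ adj j i
    irrefl  : ∀ i → ¬ T (adj i i)

open Graph public

Edge : ∀ {n} → Graph n → Fin n → Fin n → Set
Edge G i j = T (adj G i j)

data IsWalk {n} (G : Graph n) : List (Fin n) → Set where
  walk-[] : IsWalk G []
  walk-1  : ∀ v → IsWalk G (v ∷ [])
  walk-∷  : ∀ u v vs → Edge G u v → IsWalk G (v ∷ vs) → IsWalk G (u ∷ v ∷ vs)

Connected : ∀ {n} → Graph n → Set
Connected {n} G = ∀ (u v : Fin n) →
  Σ (List (Fin n)) λ vs → Σ (List (Fin n)) λ ws →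
    (vs ≡ u ∷ ws) × (last vs ≡ just v) × IsWalk G vs

IsCycle : ∀ {n} → Graph n → List (Fin n) → Set
IsCycle G []       = ⊥
IsCycle G (v ∷ vs) =
  (3 ≤ length (v ∷ vs)) × Unique (v ∷ vs) × IsWalk G (v ∷ vs) ×
  Σ (Fin _) λ w → (last (v ∷ vs) ≡ just w) × Edge G w v

Acyclic : ∀ {n} → Graph n → Set
Acyclic {n} G = ∀ (cs : List (Fin n)) → ¬ IsCycle G cs

IsTree : ∀ {n} → Graph n → Set
IsTree G = Connected G × Acyclic G

record ProperEdgeColoring {n} (G : Graph n) (k : ℕ) : Set where
  field
    κ       : ∀ i j → Edge G i j → Fin k
    κ-sym   : ∀ i j (e : Edge G i j) (e' : Edge G j i) → κ i j e ≡ κ j i e'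
    proper  : ∀ i j l (e : Edge G i j) (e' : Edge G i l) →
              κ i j e ≡ κ i l e' → j ≡ l
    surj    : ∀ (a : Fin k) → Σ (Fin n) λ i → Σ (Fin n) λ j →
              Σ (Edge G i j) λ e → κ i j e ≡ a

open ProperEdgeColoring public

ColEdge : ∀ {n k} {G : Graph n} → ProperEdgeColoring G k → Fin n → Fin n → Fin k → Set
ColEdge {G = G} c i j a = Σ (Edge G i j) λ e → κ c i j e ≡ a

IsColAut : ∀ {n k} {G : Graph n} → ProperEdgeColoring G k → Permutation′ n → Set
IsColAut {n} {k} c σ = ∀ (i j : Fin n) (a : Fin k) →
  (ColEdge c i j a → ColEdge c (σ ⟨$⟩ʳ i) (σ ⟨$⟩ʳ j) a) ×
  (ColEdge c (σ ⟨$⟩ʳ i) (σ ⟨$⟩ʳ j) a → ColEdge c i j a)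

_≈ₚ_ : ∀ {n} → Permutation′ n → Permutation′ n → Set
σ ≈ₚ τ = ∀ i → σ ⟨$⟩ʳ i ≡ τ ⟨$⟩ʳ i

IsIdentity : ∀ {n} → Permutation′ n → Set
IsIdentity σ = ∀ i → σ ⟨$⟩ʳ i ≡ i

{-# OPTIONS --safe #-}
-- A colour-preserving map ρ sends walks to walks with the same colour word and, the colouring
-- being proper, is determined by its value at one vertex; so a nontrivial colour automorphism
-- fixes no vertex. In a tree a walk whose word never repeats a colour twice in a row is a path,
-- hence has fewer than n edges. Consequently no ρ moves a vertex x along a walk whose word stays
-- reduced when closed up: the ρ-images of that walk would concatenate to arbitrarily long
-- reduced walks. Shortening a reduced walk u ⇝ σ u from both ends then shows that a nontrivial σ
-- reverses an edge. If σ and τ reverse edges coloured a and b, peel edges coloured a and b off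
-- the ends of a reduced walk between them: either σ and τ meet at a vertex, and then coincide
-- everywhere, or τ ∘ σ moves a vertex along a walk as above. Whether a nontrivial automorphism
-- exists at all is decided by exhaustive search.
module Submission where

open import Defs
open import Data.Nat using (ℕ; zero; suc; _≤_; _<_; z≤n; s≤s)
open import Data.Nat.Properties using (+-mono-≤; ≤⇒≯; m≤n+m)
open import Data.Nat.Induction using (<-wellFounded)
open import Induction.WellFounded using (Acc; acc)
open import Data.Bool using (T)
open import Data.Bool.Properties using (T-irrelevant)
open import Data.Fin using (Fin; zero; suc; finToFun; funToFin)
open import Data.Fin.Properties using (_≟_; any?; all?; injective⇒≤; finToFun-funToFin)
open import Data.Fin.Permutation
  using (Permutation′; _⟨$⟩ʳ_; _⟨$⟩ˡ_; permutation; inverseˡ; inverseʳ)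
open import Data.List
  using (List; []; _∷_; _++_; _∷ʳ_; _ʳ++_; length; last; lookup; reverse; concat; replicate;
         initLast; _∷ʳ′_)
open import Data.List.Properties
  using (++-assoc; reverse-++; unfold-reverse; length-++; length-++-≤ˡ)
open import Data.List.Membership.Propositional using (_∈_; _∉_)
open import Data.List.Membership.Propositional.Properties using (∈-lookup)
open import Data.List.Relation.Unary.All as All using (All; [])
open import Data.List.Relation.Unary.All.Properties using (anti-mono; ¬Any⇒All¬)
open import Data.List.Relation.Unary.Any using (here; there)
open import Data.List.Relation.Unary.AllPairs using ([]; _∷_)
open import Data.List.Relation.Unary.Unique.Propositional using (Unique)
open import Data.List.Relation.Unary.Linked as Linked using (Linked; []; [-]; _∷_)
open import Data.List.Relation.Binary.Subset.Propositional using (_⊆_)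
open import Data.List.Relation.Binary.Subset.Propositional.Properties using (∷⁺ʳ)
open import Data.Maybe using (just)
open import Data.Maybe.Properties using (just-injective)
open import Data.Product using (Σ; ∃; ∃₂; _×_; _,_; proj₁; proj₂)
open import Data.Sum using (_⊎_; inj₁; inj₂)
open import Data.Empty using (⊥; ⊥-elim)
open import Function using (_∘_)
open import Function.Definitions using (Injective)
open import Relation.Binary.Core using (Rel)
open import Relation.Binary.Definitions using (Symmetric)
open import Relation.Nullary using (¬_; Dec; yes; no; contradiction)
open import Relation.Nullary.Decidable using (_×-dec_; _→-dec_; ¬?; map′; decidable-stable; T?)
open import Relation.Binary.PropositionalEquality

module _ {a ℓ} {A : Set a} {R : Rel A ℓ} where

  join⁺ : ∀ {xs y ys} → Linked R (xs ∷ʳ y) → Linked R (y ∷ ys) → Linked R (xs ++ y ∷ ys)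
  join⁺ {[]}          _         l = l
  join⁺ {_ ∷ []}      (r ∷ [-]) l = r ∷ l
  join⁺ {_ ∷ x ∷ xs}  (r ∷ l′)  l = r ∷ join⁺ {x ∷ xs} l′ l

  ∷ʳ⁺ : ∀ {xs x y} → Linked R (xs ∷ʳ x) → R x y → Linked R (xs ∷ʳ x ∷ʳ y)
  ∷ʳ⁺ {xs} {x} {y} l r =
    subst (Linked R) (sym (++-assoc xs (x ∷ []) (y ∷ []))) (join⁺ l (r ∷ [-]))

  ++⁻ˡ : ∀ xs {ys} → Linked R (xs ++ ys) → Linked R xs
  ++⁻ˡ []           _       = []
  ++⁻ˡ (_ ∷ [])     _       = [-]
  ++⁻ˡ (_ ∷ y ∷ xs) (r ∷ l) = r ∷ ++⁻ˡ (y ∷ xs) l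

  replicate⁺ : ∀ {x xs} → Linked R (x ∷ xs ∷ʳ x) → ∀ m →
               Linked R (x ∷ concat (replicate m (xs ∷ʳ x)))
  replicate⁺          l zero    = [-]
  replicate⁺ {x} {xs} l (suc m) =
    subst (Linked R ∘ (x ∷_)) (sym (++-assoc xs (x ∷ []) _))
          (join⁺ {xs = x ∷ xs} l (replicate⁺ l m))

  module _ (R-sym : Symmetric R) where

    ʳ++⁺ : ∀ {x xs ys} → Linked R (x ∷ xs) → Linked R (x ∷ ys) → Linked R (xs ʳ++ x ∷ ys)
    ʳ++⁺ {xs = []}    _        l = l
    ʳ++⁺ {xs = _ ∷ _} (r ∷ l′) l = ʳ++⁺ l′ (R-sym r ∷ l)

    reverse⁺ : ∀ {xs} → Linked R xs → Linked R (reverse xs)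
    reverse⁺ {[]}    _ = []
    reverse⁺ {_ ∷ _} l = ʳ++⁺ l [-]

    mirror⁺ : ∀ {xs y} → Linked R (xs ∷ʳ y) → Linked R (xs ++ y ∷ reverse xs)
    mirror⁺ {xs} {y} l = join⁺ l (subst (Linked R) (reverse-++ xs (y ∷ [])) (reverse⁺ l))

module _ {a} {A : Set a} where

  length-concat-replicate : ∀ m {xs : List A} → 1 ≤ length xs → m ≤ length (concat (replicate m xs))
  length-concat-replicate zero    _  = z≤n
  length-concat-replicate (suc m) {xs} 1≤ =
    subst (suc m ≤_) (sym (length-++ xs)) (+-mono-≤ 1≤ (length-concat-replicate m 1≤))

  lookup-injective : ∀ {xs : List A} → Unique xs → Injective _≡_ _≡_ (lookup xs)
  lookup-injective (_ ∷ _)    {zero}  {zero}  _  = refl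
  lookup-injective (x∉ ∷ _)   {zero}  {suc j} eq = contradiction eq (All.lookup x∉ (∈-lookup j))
  lookup-injective (x∉ ∷ _)   {suc i} {zero}  eq =
    contradiction (sym eq) (All.lookup x∉ (∈-lookup i))
  lookup-injective (_ ∷ uniq) {suc i} {suc j} eq = cong suc (lookup-injective uniq eq)

Unique-length≤ : ∀ {n} {xs : List (Fin n)} → Unique xs → length xs ≤ n
Unique-length≤ = injective⇒≤ ∘ lookup-injective

IsIdentity? : ∀ {n} (σ : Permutation′ n) → Dec (IsIdentity σ)
IsIdentity? σ = all? λ i → σ ⟨$⟩ʳ i ≟ i

module _ {n k} {G : Graph n} (c : ProperEdgeColoring G k) where

  private variable
    u v x y z : Fin n
    a b : Fin k
    R S : List (Fin k)
    f g σ τ ρ : Fin n → Fin n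

  Reduced : List (Fin k) → Set
  Reduced = Linked _≢_

  ColEdge-sym : ColEdge c u v a → ColEdge c v u a
  ColEdge-sym {u} {v} (e , refl) = e′ , sym (κ-sym c u v e e′)
    where
    e′ : Edge G v u
    e′ = subst T (adj-sym G u v) e

  ColEdge-proper : ColEdge c u v a → ColEdge c u x a → v ≡ x
  ColEdge-proper (e , refl) (e′ , eq′) = proper c _ _ _ e e′ (sym eq′)

  ColEdge-functional : ColEdge c u v a → ColEdge c u v b → a ≡ b
  ColEdge-functional (e , refl) (e′ , refl) = cong (κ c _ _) (T-irrelevant e e′)

  ColorPreserving : (Fin n → Fin n) → Set
  ColorPreserving f = ∀ {i j a} → ColEdge c i j a → ColEdge c (f i) (f j) a

  data Walk : Fin n → List (Fin k) → Fin n → Set where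
    []  : Walk u [] u
    _∷_ : ColEdge c u v a → Walk v R z → Walk u (a ∷ R) z

  _++ʷ_ : Walk u R v → Walk v S z → Walk u (R ++ S) z
  []      ++ʷ w′ = w′
  (e ∷ w) ++ʷ w′ = e ∷ (w ++ʷ w′)

  _ʳ++ʷ_ : Walk u R z → Walk u S y → Walk z (R ʳ++ S) y
  []      ʳ++ʷ w′ = w′
  (e ∷ w) ʳ++ʷ w′ = w ʳ++ʷ (ColEdge-sym e ∷ w′)

  reverseʷ : Walk u R z → Walk z (reverse R) u
  reverseʷ w = w ʳ++ʷ []

  mapʷ : ColorPreserving f → Walk u R z → Walk (f u) R (f z)
  mapʷ pf []      = []
  mapʷ pf (e ∷ w) = pf e ∷ mapʷ pf w

  unsnocʷ : Walk u (R ∷ʳ a) z → ∃ λ y → Walk u R y × ColEdge c y z a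
  unsnocʷ {R = []}    (e ∷ []) = _ , [] , e
  unsnocʷ {R = _ ∷ _} (e ∷ w)  = let (y , w′ , e′) = unsnocʷ w in y , e ∷ w′ , e′

  replicateʷ : ColorPreserving ρ → Walk x R (ρ x) → ∀ m → ∃ λ y → Walk x (concat (replicate m R)) y
  replicateʷ pρ w zero    = _ , []
  replicateʷ pρ w (suc m) = let (y , w′) = replicateʷ pρ (mapʷ pρ w) m in y , w ++ʷ w′

  agree-along : ColorPreserving f → ColorPreserving g → f u ≡ g u → Walk u R z → f z ≡ g z
  agree-along pf pg eq []      = eq
  agree-along pf pg eq (e ∷ w) =
    agree-along pf pg (ColEdge-proper (pf e) (subst (λ t → ColEdge c t _ _) (sym eq) (pg e))) w

  fromIsWalk : ∀ {ws} → IsWalk G (u ∷ ws) → last (u ∷ ws) ≡ just z → ∃ λ R → Walk u R z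
  fromIsWalk {ws = []}    _                   eq with refl ← just-injective eq = [] , []
  fromIsWalk {ws = _ ∷ _} (walk-∷ _ _ _ e iw) eq =
    let (R , w) = fromIsWalk iw eq in κ c _ _ e ∷ R , (e , refl) ∷ w

  reduce : Walk u R z → ∃ λ S → Reduced S × Walk u S z
  reduce [] = [] , [] , []
  reduce (e ∷ w) with reduce w
  ... | [] , _ , w′ = _ , [-] , e ∷ w′
  reduce {R = a ∷ _} (e ∷ w) | b ∷ S , r , e′ ∷ w′ with a ≟ b
  ... | yes refl with refl ← ColEdge-proper e′ (ColEdge-sym e) = S , Linked.tail r , w′
  ... | no a≢b = a ∷ b ∷ S , a≢b ∷ r , e ∷ e′ ∷ w′

  module _ (connected : Connected G) where

    walk-between : ∀ u z → ∃ λ R → Walk u R z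
    walk-between u z with connected u z
    ... | _ , _ , refl , lst , iw = fromIsWalk iw lst

    reducedWalk : ∀ u z → ∃ λ R → Reduced R × Walk u R z
    reducedWalk u z = reduce (proj₂ (walk-between u z))

    agree : ColorPreserving f → ColorPreserving g → f u ≡ g u → ∀ z → f z ≡ g z
    agree pf pg eq z = agree-along pf pg eq (proj₂ (walk-between _ z))

    fixed⇒identity : ColorPreserving f → f u ≡ u → ∀ z → f z ≡ z
    fixed⇒identity pf = agree pf (λ e → e)

  vertices : Walk u R z → List (Fin n)
  vertices {u} []      = u ∷ []
  vertices {u} (_ ∷ w) = u ∷ vertices w

  length-vertices : (w : Walk u R z) → length (vertices w) ≡ suc (length R)
  length-vertices []      = refl
  length-vertices (_ ∷ w) = cong suc (length-vertices w)

  last-vertices : (w : Walk u R z) → last (vertices w) ≡ just z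
  last-vertices []             = refl
  last-vertices (_ ∷ [])       = refl
  last-vertices (_ ∷ w@(_ ∷ _)) = last-vertices w

  vertices-isWalk : (w : Walk u R z) → IsWalk G (vertices w)
  vertices-isWalk []              = walk-1 _
  vertices-isWalk (e ∷ [])        = walk-∷ _ _ _ (proj₁ e) (walk-1 _)
  vertices-isWalk (e ∷ w@(_ ∷ _)) = walk-∷ _ _ _ (proj₁ e) (vertices-isWalk w)

  IsPath : Walk u R z → Set
  IsPath w = Unique (vertices w)

  prefix-to : (w : Walk v R z) → u ∈ vertices w → IsPath w →
              ∃₂ λ R₁ R₂ → R₁ ++ R₂ ≡ R × Σ (Walk v R₁ u) λ p → IsPath p × vertices p ⊆ vertices w
  prefix-to []      (here refl) _ = [] , [] , refl , [] , [] ∷ [] , λ x∈ → x∈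
  prefix-to (_ ∷ _) (here refl) _ = [] , _ , refl , [] , [] ∷ [] , ∷⁺ʳ _ (λ ())
  prefix-to (e ∷ w) (there u∈) (v∉ ∷ path) =
    let (R₁ , R₂ , eq , p , p-path , p⊆w) = prefix-to w u∈ path
    in  _ ∷ R₁ , R₂ , cong (_ ∷_) eq , e ∷ p , anti-mono p⊆w v∉ ∷ p-path , ∷⁺ʳ _ p⊆w

  path+edge⇒cycle : (p : Walk v R u) → IsPath p → 2 ≤ length R → Edge G u v → IsCycle G (vertices p)
  path+edge⇒cycle (_∷_ {R = R} e p) path 2≤ uv =
    subst (3 ≤_) (sym (cong suc (length-vertices p))) (s≤s 2≤) ,
    path , vertices-isWalk (e ∷ p) , _ , last-vertices (e ∷ p) , uv

  module _ (acyclic : Acyclic G) where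

    no-return : ColEdge c u v a → (w : Walk v R z) → Reduced (a ∷ R) → IsPath w → u ∉ vertices w
    no-return e w r path u∈ with prefix-to w u∈ path
    ... | _ , _ , _    , []              , _      , _ = irrefl G _ (proj₁ e)
    ... | _ , _ , refl , e₁ ∷ []         , _      , _ =
      Linked.head r (ColEdge-functional e (ColEdge-sym e₁))
    ... | _ , _ , _    , p@(_ ∷ _ ∷ _)   , p-path , _ =
      acyclic (vertices p) (path+edge⇒cycle p p-path (s≤s (s≤s z≤n)) (proj₁ e))

    reduced⇒path : (w : Walk u R z) → Reduced R → IsPath w
    reduced⇒path []      _ = [] ∷ []
    reduced⇒path (e ∷ w) r = ¬Any⇒All¬ _ (no-return e w r path) ∷ path
      where
      path : IsPath w
      path = reduced⇒path w (Linked.tail r)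

    reduced-length< : Walk u R z → Reduced R → length R < n
    reduced-length< w r = subst (_≤ n) (length-vertices w) (Unique-length≤ (reduced⇒path w r))

    no-translation : ColorPreserving ρ → Walk x (a ∷ R) (ρ x) → Reduced (a ∷ R ∷ʳ a) → ⊥
    no-translation {ρ} {a = a} {R} pρ (e ∷ w) r = ≤⇒≯ long short
      where
      iterated : ∃ λ y → Walk _ (concat (replicate n (R ∷ʳ a))) y
      iterated = replicateʷ {ρ = ρ} pρ (w ++ʷ (pρ e ∷ [])) n
      short : length (concat (replicate n (R ∷ʳ a))) < n
      short = reduced-length< (proj₂ iterated) (Linked.tail (replicate⁺ r n))
      long : n ≤ length (concat (replicate n (R ∷ʳ a)))
      long = length-concat-replicate n (subst (1 ≤_) (sym (length-++ R)) (m≤n+m 1 (length R)))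

    module _ (pσ : ColorPreserving σ) (pτ : ColorPreserving τ) where

      no-reduced-bridge : ColEdge c u (σ u) a → ColEdge c x (τ x) b → Walk x S u →
                          Reduced (b ∷ S ∷ʳ a) → ⊥
      no-reduced-bridge {a = a} {b = b} {S = S} sa sb p r =
        no-translation {ρ = τ ∘ σ} (pτ ∘ pσ)
          (sb ∷ mapʷ pτ (p ++ʷ (sa ∷ reverseʷ (mapʷ pσ p))))
          (subst Reduced closed (mirror⁺ ≢-sym {xs = b ∷ S} r))
        where
        closed : (b ∷ S) ++ a ∷ reverse (b ∷ S) ≡ b ∷ (S ++ a ∷ reverse S) ∷ʳ b
        closed = begin
          b ∷ S ++ a ∷ reverse (b ∷ S)   ≡⟨ cong (λ t → b ∷ S ++ a ∷ t) (unfold-reverse b S) ⟩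
          b ∷ S ++ a ∷ reverse S ∷ʳ b    ≡⟨ cong (b ∷_) (sym (++-assoc S _ (b ∷ []))) ⟩
          b ∷ (S ++ a ∷ reverse S) ∷ʳ b  ∎
          where open ≡-Reasoning

      meet-back : ColEdge c u (σ u) a → ColEdge c x (τ x) b → Walk x S u → Reduced (S ∷ʳ a) →
                  ∃ λ z → σ z ≡ τ z
      meet-back {a = a} {b = b} sa sb [] _ with a ≟ b
      ... | yes refl = _ , ColEdge-proper sa sb
      ... | no a≢b   = ⊥-elim (no-reduced-bridge sa sb [] (≢-sym a≢b ∷ [-]))
      meet-back {b = b} sa sb (_∷_ {a = q} e p) r with q ≟ b
      ... | no q≢b   = ⊥-elim (no-reduced-bridge sa sb (e ∷ p) (≢-sym q≢b ∷ r))
      ... | yes refl with refl ← ColEdge-proper e sb = meet-back sa (pτ sb) p (Linked.tail r)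

      meet : ColEdge c u (σ u) a → ColEdge c x (τ x) b → Walk u R x → Reduced R →
             ∃ λ z → σ z ≡ τ z
      meet sa sb [] _ = meet-back sa sb [] [-]
      meet {a = a} sa sb (_∷_ {a = p} {R = R} e w) r with p ≟ a
      ... | yes refl with refl ← ColEdge-proper e sa = meet (pσ sa) sb w (Linked.tail r)
      ... | no p≢a   = meet-back sa sb (reverseʷ (e ∷ w))
        (subst Reduced (unfold-reverse a (p ∷ R)) (reverse⁺ ≢-sym {a ∷ p ∷ R} (≢-sym p≢a ∷ r)))

  module _ (connected : Connected G) (acyclic : Acyclic G) where

    reversed-edge : ColorPreserving σ → (∀ u → σ u ≢ u) → Fin n → ∃₂ λ v a → ColEdge c v (σ v) a
    reversed-edge {σ} pσ fixed-point-free u₀ =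
      let (_ , r , w) = reducedWalk connected u₀ (σ u₀) in shrink w refl r (<-wellFounded _)
      where
      shrink : Walk u R z → z ≡ σ u → Reduced R → Acc _<_ (length R) →
               ∃₂ λ v a → ColEdge c v (σ v) a
      shrink {u} [] eq _ _ = ⊥-elim (fixed-point-free u (sym eq))
      shrink {R = a ∷ R} (e ∷ w) refl r (acc rs) with initLast R
      shrink (e ∷ []) refl _ _ | [] = _ , _ , e
      shrink {R = a ∷ _} (e ∷ w) refl r (acc rs) | M ∷ʳ′ b with a ≟ b
      ... | no a≢b = ⊥-elim (no-translation acyclic pσ (e ∷ w) (∷ʳ⁺ {xs = a ∷ M} r (a≢b ∘ sym)))
      ... | yes refl with unsnocʷ w
      ...   | _ , w′ , e′ with refl ← ColEdge-proper (ColEdge-sym e′) (pσ e) =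
        shrink w′ refl (++⁻ˡ M (Linked.tail r)) (rs (s≤s (length-++-≤ˡ M)))

    nontrivial-unique : ColorPreserving σ → ColorPreserving τ →
                        ¬ (∀ i → σ i ≡ i) → ¬ (∀ i → τ i ≡ i) → ∀ z → σ z ≡ τ z
    nontrivial-unique pσ pτ σ≠id τ≠id z =
      let (u , _ , sa) = reversed-edge pσ (λ _ → σ≠id ∘ fixed⇒identity connected pσ) z
          (x , _ , sb) = reversed-edge pτ (λ _ → τ≠id ∘ fixed⇒identity connected pτ) z
          (_ , r , w)  = reducedWalk connected u x
          (_ , eq)     = meet acyclic pσ pτ sa sb w r
      in  agree connected pσ pτ eq z

  ColEdge? : ∀ i j a → Dec (ColEdge c i j a)
  ColEdge? i j a with T? (adj G i j)
  ... | no ¬e = no (¬e ∘ proj₁)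
  ... | yes e =
    map′ (e ,_) (λ (e′ , eq) → trans (cong (κ c i j) (T-irrelevant e e′)) eq) (κ c i j e ≟ a)

  -- IsColAut c τ unfolds to IsColorAut (τ ⟨$⟩ʳ_).
  IsColorAut : (Fin n → Fin n) → Set
  IsColorAut f = ∀ i j a → (ColEdge c i j a → ColEdge c (f i) (f j) a) ×
                           (ColEdge c (f i) (f j) a → ColEdge c i j a)

  IsColorAut⇒ColorPreserving : IsColorAut f → ColorPreserving f
  IsColorAut⇒ColorPreserving aut e = proj₁ (aut _ _ _) e

  IsColorAut? : ∀ f → Dec (IsColorAut f)
  IsColorAut? f = all? λ i → all? λ j → all? λ a →
    (ColEdge? i j a →-dec ColEdge? (f i) (f j) a) ×-dec
    (ColEdge? (f i) (f j) a →-dec ColEdge? i j a)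

  IsColorAut-resp : f ≗ g → IsColorAut f → IsColorAut g
  IsColorAut-resp {f} {g} f≗g aut i j a =
    (λ e → move (proj₁ (aut i j a) e)) , (λ e → proj₂ (aut i j a) (move⁻ e))
    where
    move : ColEdge c (f i) (f j) a → ColEdge c (g i) (g j) a
    move = subst₂ (λ p q → ColEdge c p q a) (f≗g i) (f≗g j)
    move⁻ : ColEdge c (g i) (g j) a → ColEdge c (f i) (f j) a
    move⁻ = subst₂ (λ p q → ColEdge c p q a) (sym (f≗g i)) (sym (f≗g j))

  NontrivialColorAut : (Fin n → Fin n) → (Fin n → Fin n) → Set
  NontrivialColorAut f g =
    (∀ y → f (g y) ≡ y) × (∀ x → g (f x) ≡ x) × IsColorAut f × ¬ (∀ i → f i ≡ i)

  NontrivialColorAut? : ∀ f g → Dec (NontrivialColorAut f g)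
  NontrivialColorAut? f g =
    all? (λ y → f (g y) ≟ y) ×-dec all? (λ x → g (f x) ≟ x) ×-dec
    IsColorAut? f ×-dec ¬? (all? λ i → f i ≟ i)

  NontrivialColorAut-resp : ∀ {f′ g′} → f ≗ f′ → g ≗ g′ →
                            NontrivialColorAut f g → NontrivialColorAut f′ g′
  NontrivialColorAut-resp {f} {g} {f′} {g′} f≗f′ g≗g′ (fg , gf , aut , f≠id) =
    (λ y → trans (sym (f≗f′ (g′ y))) (trans (cong f (sym (g≗g′ y))) (fg y))) ,
    (λ x → trans (sym (g≗g′ (f′ x))) (trans (cong g (sym (f≗f′ x))) (gf x))) ,
    IsColorAut-resp f≗f′ aut ,
    λ f′=id → f≠id λ i → trans (f≗f′ i) (f′=id i)

  nontrivial-aut? : Dec (∃ λ (τ : Permutation′ n) → IsColAut c τ × ¬ IsIdentity τ)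
  nontrivial-aut? =
    map′ decode encode (any? λ i → any? λ j → NontrivialColorAut? (finToFun i) (finToFun j))
    where
    decode : (∃₂ λ i j → NontrivialColorAut (finToFun i) (finToFun j)) →
             ∃ λ (τ : Permutation′ n) → IsColAut c τ × ¬ IsIdentity τ
    decode (i , j , fg , gf , aut , ≠id) = permutation (finToFun i) (finToFun j) fg gf , aut , ≠id
    encode : (∃ λ (τ : Permutation′ n) → IsColAut c τ × ¬ IsIdentity τ) →
             ∃₂ λ i j → NontrivialColorAut (finToFun i) (finToFun j)
    encode (τ , aut , ≠id) =
      funToFin (τ ⟨$⟩ʳ_) , funToFin (τ ⟨$⟩ˡ_) ,
      NontrivialColorAut-resp (sym ∘ finToFun-funToFin _) (sym ∘ finToFun-funToFin _)
        ((λ _ → inverseʳ τ) , (λ _ → inverseˡ τ) , aut , ≠id)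

  identity-or-equal : IsTree G → ∀ {σ τ : Permutation′ n} → IsColAut c σ → IsColAut c τ →
                      ¬ IsIdentity τ → IsIdentity σ ⊎ σ ≈ₚ τ
  identity-or-equal (connected , acyclic) {σ} autσ autτ τ≠id with IsIdentity? σ
  ... | yes σ=id = inj₁ σ=id
  ... | no σ≠id  = inj₂ (nontrivial-unique connected acyclic (IsColorAut⇒ColorPreserving autσ)
                                            (IsColorAut⇒ColorPreserving autτ) σ≠id τ≠id)

lemma3p10 : ∀ (n k : ℕ) (G : Graph n) (c : ProperEdgeColoring G k) →
    IsTree G →
    (∀ (σ : Permutation′ n) → IsColAut c σ → IsIdentity σ)
    ⊎ Σ (Permutation′ n) (λ τ → IsColAut c τ × ¬ IsIdentity τ ×
        (∀ (σ : Permutation′ n) → IsColAut c σ → IsIdentity σ ⊎ σ ≈ₚ τ))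
lemma3p10 n k G c tree with nontrivial-aut? c
... | no none = inj₁ λ σ aut → decidable-stable (IsIdentity? σ) (λ σ≠id → none (σ , aut , σ≠id))
... | yes (τ , autτ , τ≠id) =
  inj₂ (τ , autτ , τ≠id , λ σ autσ → identity-or-equal c tree {σ} {τ} autσ autτ τ≠id)
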